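{- The edge-locating chromatic number is not monotone under taking subgraphs: there exist finite simple connected graphs $G$ and $H$ such that $G$ is a proper subgraph of $H$ and $\chi'_L(H)<\chi'_L(G)$.
   Context: For a proper edge coloring $c:E(G)\to\{1,\dots,k\}$ of a connected graph $G$, let $\pi=(\mathcal{C}_1,\dots,\mathcal{C}_k)$ be the ordered partition of $E(G)$ into color classes. For a vertex $v$ and an edge $e=xy$, $d(v,e)=\min\{d(v,x),d(v,y)\}$, and $d(v,\mathcal{C}_i)=\min\{d(v,e): e\in\mathcal{C}_i\}$. The edge color code of $v$ is $c_\pi(v)=(d(v,\mathcal{C}_1),\dots,d(v,\mathcal{C}_k))$. The coloring is an edge-locating coloring if distinct vertices have distinct edge color codes; $\chi'_L(G)$ is the minimum number of colors in an edge-locating coloring of $G$. -}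

module Defs where

open import Data.Nat using (ℕ; zero; suc; _≤_; _<_)
open import Data.Fin using (Fin)
open import Data.Bool using (Bool; T)
open import Data.Product using (Σ; ∃; ∃-syntax; _×_; _,_)
open import Data.Sum using (_⊎_)
open import Relation.Nullary using (¬_)
open import Relation.Binary.PropositionalEquality using (_≡_; _≢_)

record Graph (n : ℕ) : Set where
  field
    adj   : Fin n → Fin n → Bool
    sym   : ∀ x y → adj x y ≡ adj y x
    irrfl : ∀ x → adj x x ≡ Bool.false
open Graph public

Adj : ∀ {n} → Graph n → Fin n → Fin n → Set
Adj G x y = T (adj G x y)

data Walk {n : ℕ} (G : Graph n) : Fin n → Fin n → ℕ → Set where
  here : ∀ {u} → Walk G u u 0
  step : ∀ {u w v k} → Adj G u w → Walk G w v k → Walk G u v (suc k)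

Connected : ∀ {n} → Graph n → Set
Connected {n} G = ∀ (u v : Fin n) → ∃[ k ] Walk G u v k

IsDist : ∀ {n} → Graph n → Fin n → Fin n → ℕ → Set
IsDist G u v m = Walk G u v m × (∀ m' → m' < m → ¬ Walk G u v m')

-- An edge coloring with k colors: a color for each (ordered) adjacent pair,
-- required symmetric on edges (so it is a coloring of undirected edges).
-- Values on non-adjacent pairs are irrelevant.
record EdgeColoring {n : ℕ} (G : Graph n) (k : ℕ) : Set where
  field
    col      : Fin n → Fin n → Fin k
    col-sym  : ∀ x y → Adj G x y → col x y ≡ col y x
    proper   : ∀ x y z → Adj G x y → Adj G x z → y ≢ z → col x y ≢ col x z
    -- each color class C_i is nonempty (π is an ordered partition into k classes)
    onto     : ∀ (i : Fin k) → ∃[ x ] ∃[ y ] (Adj G x y × col x y ≡ i)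
open EdgeColoring public

IsDistEdge : ∀ {n} → Graph n → Fin n → Fin n → Fin n → ℕ → Set
IsDistEdge G v x y m =
  (IsDist G v x m × (∀ m' → IsDist G v y m' → m ≤ m'))
  ⊎ (IsDist G v y m × (∀ m' → IsDist G v x m' → m ≤ m'))

IsDistClass : ∀ {n k} (G : Graph n) → EdgeColoring G k → Fin n → Fin k → ℕ → Set
IsDistClass G c v i m =
  (∃[ x ] ∃[ y ] (Adj G x y × col c x y ≡ i × IsDistEdge G v x y m))
  × (∀ x y m' → Adj G x y → col c x y ≡ i → IsDistEdge G v x y m' → m ≤ m')

IsEdgeLocating : ∀ {n k} (G : Graph n) → EdgeColoring G k → Set
IsEdgeLocating {n} {k} G c =
  ∀ (u v : Fin n) → u ≢ v →
    ∃[ i ] ∃[ a ] ∃[ b ] (IsDistClass G c u i a × IsDistClass G c v i b × a ≢ b)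

IsChiL : ∀ {n} → Graph n → ℕ → Set
IsChiL G k =
  (Σ (EdgeColoring G k) (IsEdgeLocating G))
  × (∀ j → (c : EdgeColoring G j) → IsEdgeLocating G c → k ≤ j)

record Subgraph {m n : ℕ} (G : Graph m) (H : Graph n) : Set where
  field
    emb      : Fin m → Fin n
    emb-inj  : ∀ x y → emb x ≡ emb y → x ≡ y
    emb-edge : ∀ x y → Adj G x y → Adj H (emb x) (emb y)
open Subgraph public

ProperSubgraph : ∀ {m n} → Graph m → Graph n → Set
ProperSubgraph {m} {n} G H =
  Σ (Subgraph G H) λ s →
    (∃[ w ] (∀ x → emb s x ≢ w))
    ⊎ (∃[ x ] ∃[ y ] (Adj H (emb s x) (emb s y) × ¬ Adj G x y))

-- Let B be the bowtie (two triangles 012 and 034 sharing the hub 0) and B⁺ = B + 13.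
-- Both hubs have degree 4, so every colouring uses at least 4 colours, and explicit
-- colourings show χ'_L(B⁺) ≤ 4 and χ'_L(B) ≤ 5.  With only 4 colours on B the spokes
-- use every colour once, so the chord 12 repeats the colour of a spoke 0v of the other
-- triangle and the chord 34 that of a spoke 0u of the first one.  Then u and v see the
-- same two colours, and every other colour at distance 1 through the hub: equal codes.
module Submission where

open import Defs
open import Data.Nat using (ℕ; zero; suc; _<_; _≤_; z≤n; s≤s)
open import Data.Nat.Properties using (≤-refl; ≤-antisym; ≮⇒≥; ≤∧≢⇒<; m<1+n⇒m<n∨m≡n; n<1+n)
  renaming (_≟_ to _≟ℕ_)
open import Data.Fin using (Fin; #_) renaming (zero to fzero; suc to fsuc)
open import Data.Fin.Properties using (all?; any?; pigeonhole; injective⇒≤; suc-injective; <⇒≢)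
  renaming (_≟_ to _≟F_)
open import Data.Bool using (Bool; true; false; T; _∨_)
open import Data.Bool.Properties using (∨-comm)
open import Data.Unit using (tt)
open import Data.Empty using (⊥-elim)
open import Data.Maybe using (Maybe; just; nothing; is-just; to-witness-T)
open import Data.Product using (Σ; ∃-syntax; _×_; _,_)
open import Data.Sum using (_⊎_; inj₁; inj₂)
open import Function using (_∘_)
open import Function.Definitions using (Injective)
open import Relation.Nullary using (¬_; Dec; yes; no)
open import Relation.Nullary.Decidable
  using (True; toWitness; from-yes; map′; _×-dec_; _⊎-dec_; _→-dec_; ¬?; T?)
open import Relation.Binary.PropositionalEquality using (_≡_; _≢_; refl; trans; cong; cong₂; subst)
  renaming (sym to ≡-sym)

-- Pigeonhole on the k + 1 values i, f 0, …, f (k − 1): the collision must involve i.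
injective⇒surjective : ∀ {k} {f : Fin k → Fin k} → Injective _≡_ _≡_ f → ∀ i → ∃[ p ] f p ≡ i
injective⇒surjective {k} {f} f-inj i
  with pigeonhole (n<1+n k) (λ { fzero → i ; (fsuc p) → f p })
... | fzero  , fsuc q , _   , i≡fq  = q , ≡-sym i≡fq
... | fsuc p , fsuc q , p<q , fp≡fq = ⊥-elim (<⇒≢ p<q (cong fsuc (f-inj fp≡fq)))

fromEdges : ∀ {n} (edge : Fin n → Fin n → Bool) → (∀ x → edge x x ≡ false) → Graph n
fromEdges edge loopless = record
  { adj   = λ x y → edge x y ∨ edge y x
  ; sym   = λ x y → ∨-comm (edge x y) (edge y x)
  ; irrfl = λ x → cong₂ _∨_ (loopless x) (loopless x)
  }

module _ {n} (G : Graph n) where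

  adj-sym : ∀ {x y} → Adj G x y → Adj G y x
  adj-sym {x} {y} = subst T (sym G x y)

  adj⇒≢ : ∀ {x y} → Adj G x y → x ≢ y
  adj⇒≢ {x} xy refl = subst T (irrfl G x) xy

  NeighboursExactly : Fin n → Fin n → Fin n → Set
  NeighboursExactly u a b = Adj G u a × Adj G u b × (∀ z → Adj G u z → z ≡ a ⊎ z ≡ b)

  walk? : ∀ u v m → Dec (Walk G u v m)
  walk? u v zero with u ≟F v
  ... | yes refl = yes here
  ... | no u≢v   = no λ { here → u≢v refl }
  walk? u v (suc m) =
    map′ (λ (w , a , p) → step a p) (λ { (step a p) → _ , a , p })
         (any? λ w → T? (adj G u w) ×-dec walk? w v m)

  dominating⇒connected : ∀ h → (∀ u → u ≡ h ⊎ Adj G u h) → Connected G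
  dominating⇒connected h dom u v with dom u | dom v
  ... | inj₁ refl | inj₁ refl = 0 , here
  ... | inj₁ refl | inj₂ vh   = 1 , step (adj-sym vh) here
  ... | inj₂ uh   | inj₁ refl = 1 , step uh here
  ... | inj₂ uh   | inj₂ vh   = 2 , step uh (step (adj-sym vh) here)

  checkedColouring : ∀ {k} (f : Fin n → Fin n → Fin k) →
    {True (all? λ x → all? λ y → T? (adj G x y) →-dec (f x y ≟F f y x))} →
    {True (all? λ x → all? λ y → all? λ z → T? (adj G x y) →-dec (T? (adj G x z) →-dec
                                  (¬? (y ≟F z) →-dec ¬? (f x y ≟F f x z))))} →
    {True (all? λ i → any? λ x → any? λ y → T? (adj G x y) ×-dec (f x y ≟F i))} →
    EdgeColoring G k
  checkedColouring f {s} {p} {o} =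
    record { col = f ; col-sym = toWitness s ; proper = toWitness p ; onto = toWitness o }

module _ {n k} {G : Graph n} (c : EdgeColoring G k) where

  ColourAt : Fin n → Fin k → Set
  ColourAt x i = ∃[ y ] (Adj G x y × col c x y ≡ i)

  colourAt? : ∀ x i → Dec (ColourAt x i)
  colourAt? x i = any? λ y → T? (adj G x y) ×-dec (col c x y ≟F i)

  other-end-coloured : ∀ {x y i} → Adj G x y → col c x y ≡ i → ColourAt y i
  other-end-coloured {x} {y} a e = x , adj-sym G a , trans (≡-sym (col-sym c x y a)) e

  -- d(u, C_i) is the least m such that Reaches u i m.
  Reaches : Fin n → Fin k → ℕ → Set
  Reaches u i m = ∃[ x ] (Walk G u x m × ColourAt x i)

  reaches? : ∀ u i m → Dec (Reaches u i m)
  reaches? u i m = any? λ x → walk? G u x m ×-dec colourAt? x i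

  dist-edge⇒reaches : ∀ {u x y i m} → Adj G x y → col c x y ≡ i →
                      IsDistEdge G u x y m → Reaches u i m
  dist-edge⇒reaches {x = x} a e (inj₁ ((w , _) , _)) = x , w , _ , a , e
  dist-edge⇒reaches {y = y} a e (inj₂ ((w , _) , _)) = y , w , other-end-coloured a e

  first-reach⇒dist-class : ∀ {u i m} → Reaches u i m → (∀ {l} → l < m → ¬ Reaches u i l) →
                           IsDistClass G c u i m
  first-reach⇒dist-class {u} {i} {m} (x , w , y , a , e) earlier =
    (x , y , a , e , inj₁ ((w , λ l l<m wl → earlier l<m (x , wl , y , a , e)) ,
                           λ l (wl , _) → minimal (y , wl , other-end-coloured a e)))
    , λ x′ y′ l a′ e′ d → minimal (dist-edge⇒reaches a′ e′ d)
    where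
    minimal : ∀ {l} → Reaches u i l → m ≤ l
    minimal r = ≮⇒≥ λ l<m → earlier l<m r

  dist-class-unique : ∀ {u i a b} → IsDistClass G c u i a → IsDistClass G c u i b → a ≡ b
  dist-class-unique ((x , y , axy , ex , dx) , a-min) ((x′ , y′ , axy′ , ex′ , dx′) , b-min) =
    ≤-antisym (a-min x′ y′ _ axy′ ex′ dx′) (b-min x y _ axy ex dx)

  dist-class-zero : ∀ {u i} → ColourAt u i → IsDistClass G c u i 0
  dist-class-zero {u} iu = first-reach⇒dist-class (u , here , iu) λ ()

  dist-class-one : ∀ {u w i} → ¬ ColourAt u i → Adj G u w → ColourAt w i → IsDistClass G c u i 1
  dist-class-one {u} ¬iu uw iw = first-reach⇒dist-class (_ , step uw here , iw) λ
    { (s≤s z≤n) (_ , here , iu) → ¬iu iu }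

  dist-class-from : ∀ u i (fuel m : ℕ) → (∀ {l} → l < m → ¬ Reaches u i l) →
                    Maybe (∃[ d ] IsDistClass G c u i d)
  dist-class-from u i zero       m earlier = nothing
  dist-class-from u i (suc fuel) m earlier with reaches? u i m
  ... | yes r  = just (m , first-reach⇒dist-class r earlier)
  ... | no ¬r  = dist-class-from u i fuel (suc m) λ l<1+m → case (m<1+n⇒m<n∨m≡n l<1+m)
    where
    case : ∀ {l} → l < m ⊎ l ≡ m → ¬ Reaches u i l
    case (inj₁ l<m)  = earlier l<m
    case (inj₂ refl) = ¬r

  -- Returns nothing only if d(u, C_i) ≥ n, which cannot happen in a connected graph.
  dist-class? : ∀ u i → Maybe (∃[ d ] IsDistClass G c u i d)
  dist-class? u i = dist-class-from u i n 0 λ ()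

  SeparatedBy : Fin n → Fin n → Fin k → Set
  SeparatedBy u v i = ∃[ a ] ∃[ b ] (IsDistClass G c u i a × IsDistClass G c v i b × a ≢ b)

  Separated : Fin n → Fin n → Set
  Separated u v = ∃[ i ] SeparatedBy u v i

  separatedBy? : ∀ u v i → Maybe (SeparatedBy u v i)
  separatedBy? u v i with dist-class? u i | dist-class? v i
  ... | just (a , da) | just (b , db) with a ≟ℕ b
  ...   | no a≢b = just (a , b , da , db , a≢b)
  ...   | yes _  = nothing
  separatedBy? u v i | _ | _ = nothing

  locating-by-search :
    True (all? λ u → all? λ v → ¬? (u ≟F v) →-dec any? λ i → T? (is-just (separatedBy? u v i))) →
    IsEdgeLocating G c
  locating-by-search found u v u≢v with toWitness found u v u≢v
  ... | i , sep = i , to-witness-T (separatedBy? u v i) sep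

  spoke-colours-injective : ∀ {d w} (s : Fin d → Fin n) → (∀ p → Adj G w (s p)) →
                            Injective _≡_ _≡_ s → Injective _≡_ _≡_ (λ p → col c w (s p))
  spoke-colours-injective {w = w} s spoke s-inj {p} {q} same with p ≟F q
  ... | yes p≡q = p≡q
  ... | no p≢q  = ⊥-elim (proper c w (s p) (s q) (spoke p) (spoke q) (p≢q ∘ s-inj) same)

  degree≤colours : ∀ {d w} (s : Fin d → Fin n) → (∀ p → Adj G w (s p)) →
                   Injective _≡_ _≡_ s → d ≤ k
  degree≤colours s spoke s-inj = injective⇒≤ (spoke-colours-injective s spoke s-inj)

  -- Each colour class is at distance 0 from both u and v, or at distance 1 from both via w.
  twins-not-separated : ∀ {u v w} → (∀ i → ColourAt w i) → Adj G u w → Adj G v w →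
                        (∀ {i} → ColourAt u i → ColourAt v i) →
                        (∀ {i} → ColourAt v i → ColourAt u i) → ¬ Separated u v
  twins-not-separated all-at-w uw vw u⊆v v⊆u (i , a , b , da , db , a≢b) with colourAt? _ i
  ... | yes iu = a≢b (trans (dist-class-unique da (dist-class-zero iu))
                            (dist-class-unique (dist-class-zero (u⊆v iu)) db))
  ... | no ¬iu = a≢b (trans (dist-class-unique da (dist-class-one ¬iu uw (all-at-w i)))
                            (dist-class-unique (dist-class-one (¬iu ∘ v⊆u) vw (all-at-w i)) db))

  colours-of-degree-two : ∀ {u a b i} → NeighboursExactly G u a b → ColourAt u i →
                          col c u a ≡ i ⊎ col c u b ≡ i
  colours-of-degree-two (_ , _ , only) (z , uz , e) with only _ uz
  ... | inj₁ refl = inj₁ e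
  ... | inj₂ refl = inj₂ e

  crossed-chords-not-separated :
    ∀ {w u u′ v v′} → (∀ i → ColourAt w i) →
    NeighboursExactly G u w u′ → NeighboursExactly G v w v′ →
    col c u u′ ≡ col c w v → col c v v′ ≡ col c w u → ¬ Separated u v
  crossed-chords-not-separated {w} {u} {u′} {v} {v′} all-at-w
    Nu@(uw , uu′ , _) Nv@(vw , vv′ , _) uu′≡wv vv′≡wu = twins-not-separated all-at-w uw vw u⊆v v⊆u
    where
    u⊆v : ∀ {i} → ColourAt u i → ColourAt v i
    u⊆v iu with colours-of-degree-two Nu iu
    ... | inj₁ e = v′ , vv′ , trans vv′≡wu (trans (col-sym c w u (adj-sym G uw)) e)
    ... | inj₂ e = w , vw , trans (col-sym c v w vw) (trans (≡-sym uu′≡wv) e)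
    v⊆u : ∀ {i} → ColourAt v i → ColourAt u i
    v⊆u iv with colours-of-degree-two Nv iv
    ... | inj₁ e = u′ , uu′ , trans uu′≡wv (trans (col-sym c w v (adj-sym G vw)) e)
    ... | inj₂ e = w , uw , trans (col-sym c u w uw) (trans (≡-sym vv′≡wu) e)

  hub-sees-every-colour : ∀ {w} (s : Fin k → Fin n) → (∀ p → Adj G w (s p)) →
                         Injective _≡_ _≡_ s → ∀ i → ColourAt w i
  hub-sees-every-colour s spoke s-inj i
    with injective⇒surjective (spoke-colours-injective s spoke s-inj) i
  ... | p , e = s p , spoke p , e

  spoke≢chord : ∀ {w a b} → Adj G w a → Adj G a b → Adj G w b → col c w a ≢ col c a b
  spoke≢chord {w} {a} {b} wa ab wb e =
    proper c a w b (adj-sym G wa) ab (adj⇒≢ G wb) (trans (col-sym c a w (adj-sym G wa)) e)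

pattern v0 = fzero
pattern v1 = fsuc fzero
pattern v2 = fsuc (fsuc fzero)
pattern v3 = fsuc (fsuc (fsuc fzero))
pattern v4 = fsuc (fsuc (fsuc (fsuc fzero)))

bowtieEdge : Fin 5 → Fin 5 → Bool
bowtieEdge v0 v1 = true
bowtieEdge v0 v2 = true
bowtieEdge v0 v3 = true
bowtieEdge v0 v4 = true
bowtieEdge v1 v2 = true
bowtieEdge v3 v4 = true
bowtieEdge _  _  = false

chordedBowtieEdge : Fin 5 → Fin 5 → Bool
chordedBowtieEdge v1 v3 = true
chordedBowtieEdge x  y  = bowtieEdge x y

bowtie : Graph 5
bowtie = fromEdges bowtieEdge λ { v0 → refl ; v1 → refl ; v2 → refl ; v3 → refl ; v4 → refl }

chordedBowtie : Graph 5
chordedBowtie =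
  fromEdges chordedBowtieEdge λ { v0 → refl ; v1 → refl ; v2 → refl ; v3 → refl ; v4 → refl }

bowtie-hub-spokes : ∀ p → Adj bowtie v0 (fsuc p)
bowtie-hub-spokes = from-yes (all? λ p → T? (adj bowtie v0 (fsuc p)))

chordedBowtie-hub-spokes : ∀ p → Adj chordedBowtie v0 (fsuc p)
chordedBowtie-hub-spokes = from-yes (all? λ p → T? (adj chordedBowtie v0 (fsuc p)))

bowtie-dominated : ∀ u → u ≡ v0 ⊎ Adj bowtie u v0
bowtie-dominated = from-yes (all? λ u → (u ≟F v0) ⊎-dec T? (adj bowtie u v0))

chordedBowtie-dominated : ∀ u → u ≡ v0 ⊎ Adj chordedBowtie u v0
chordedBowtie-dominated = from-yes (all? λ u → (u ≟F v0) ⊎-dec T? (adj chordedBowtie u v0))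

bowtie⊂chordedBowtie : ProperSubgraph bowtie chordedBowtie
bowtie⊂chordedBowtie =
  record { emb = λ x → x ; emb-inj = λ _ _ e → e
         ; emb-edge = from-yes (all? λ x → all? λ y →
                                  T? (adj bowtie x y) →-dec T? (adj chordedBowtie x y)) }
  , inj₂ (v1 , v3 , tt , λ ())

partner : Fin 5 → Fin 5
partner v1 = v2
partner v2 = v1
partner v3 = v4
partner v4 = v3
partner x  = x

bowtie-leaf-neighbours : ∀ u → Adj bowtie v0 u → NeighboursExactly bowtie u v0 (partner u)
bowtie-leaf-neighbours = from-yes (all? λ u → T? (adj bowtie v0 u) →-dec
  (T? (adj bowtie u v0) ×-dec T? (adj bowtie u (partner u)) ×-dec
   all? λ z → T? (adj bowtie u z) →-dec ((z ≟F v0) ⊎-dec (z ≟F partner u))))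

bowtieColour : Fin 5 → Fin 5 → Fin 5
bowtieColour v0 v1 = # 0
bowtieColour v1 v0 = # 0
bowtieColour v0 v2 = # 1
bowtieColour v2 v0 = # 1
bowtieColour v0 v3 = # 2
bowtieColour v3 v0 = # 2
bowtieColour v0 v4 = # 3
bowtieColour v4 v0 = # 3
bowtieColour v1 v2 = # 2
bowtieColour v2 v1 = # 2
bowtieColour v3 v4 = # 4
bowtieColour v4 v3 = # 4
bowtieColour _  _  = # 0

chordedBowtieColour : Fin 5 → Fin 5 → Fin 4
chordedBowtieColour v0 v1 = # 0
chordedBowtieColour v1 v0 = # 0
chordedBowtieColour v0 v2 = # 1
chordedBowtieColour v2 v0 = # 1
chordedBowtieColour v0 v3 = # 2
chordedBowtieColour v3 v0 = # 2
chordedBowtieColour v0 v4 = # 3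
chordedBowtieColour v4 v0 = # 3
chordedBowtieColour v1 v2 = # 2
chordedBowtieColour v2 v1 = # 2
chordedBowtieColour v3 v4 = # 1
chordedBowtieColour v4 v3 = # 1
chordedBowtieColour v1 v3 = # 3
chordedBowtieColour v3 v1 = # 3
chordedBowtieColour _  _  = # 0

bowtie-locating : Σ (EdgeColoring bowtie 5) (IsEdgeLocating bowtie)
bowtie-locating = c , locating-by-search c _
  where c = checkedColouring bowtie bowtieColour

chordedBowtie-locating : Σ (EdgeColoring chordedBowtie 4) (IsEdgeLocating chordedBowtie)
chordedBowtie-locating = c , locating-by-search c _
  where c = checkedColouring chordedBowtie chordedBowtieColour

chordedBowtie-needs-four :
  ∀ j (c : EdgeColoring chordedBowtie j) → IsEdgeLocating chordedBowtie c → 4 ≤ j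
chordedBowtie-needs-four j c _ = degree≤colours c fsuc chordedBowtie-hub-spokes suc-injective

bowtie-hub-sees-every-colour : (c : EdgeColoring bowtie 4) → ∀ i → ColourAt c v0 i
bowtie-hub-sees-every-colour c = hub-sees-every-colour c fsuc bowtie-hub-spokes suc-injective

bowtie-crossed-leaves-not-separated :
  (c : EdgeColoring bowtie 4) → ∀ {u v} → Adj bowtie v0 u → Adj bowtie v0 v →
  col c u (partner u) ≡ col c v0 v → col c v (partner v) ≡ col c v0 u → ¬ Separated c u v
bowtie-crossed-leaves-not-separated c {u} {v} 0u 0v =
  crossed-chords-not-separated c (bowtie-hub-sees-every-colour c)
    (bowtie-leaf-neighbours u 0u) (bowtie-leaf-neighbours v 0v)

bowtie-four-not-locating : (c : EdgeColoring bowtie 4) → ¬ IsEdgeLocating bowtie c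
bowtie-four-not-locating c locating
  with bowtie-hub-sees-every-colour c (col c v1 v2) | bowtie-hub-sees-every-colour c (col c v3 v4)
... | v0 , () , _ | _
... | _ | v0 , () , _
... | v1 , _ , e | _ = spoke≢chord c tt tt tt e
... | v2 , _ , e | _ = spoke≢chord c tt tt tt (trans e (col-sym c v1 v2 tt))
... | _ | v3 , _ , e = spoke≢chord c tt tt tt e
... | _ | v4 , _ , e = spoke≢chord c tt tt tt (trans e (col-sym c v3 v4 tt))
... | v3 , _ , e₁ | v1 , _ , e₂ =
  bowtie-crossed-leaves-not-separated c tt tt
    (≡-sym e₁) (≡-sym e₂) (locating v1 v3 λ ())
... | v3 , _ , e₁ | v2 , _ , e₂ =
  bowtie-crossed-leaves-not-separated c tt tt
    (trans (col-sym c v2 v1 tt) (≡-sym e₁)) (≡-sym e₂) (locating v2 v3 λ ())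
... | v4 , _ , e₁ | v1 , _ , e₂ =
  bowtie-crossed-leaves-not-separated c tt tt
    (≡-sym e₁) (trans (col-sym c v4 v3 tt) (≡-sym e₂)) (locating v1 v4 λ ())
... | v4 , _ , e₁ | v2 , _ , e₂ =
  bowtie-crossed-leaves-not-separated c tt tt
    (trans (col-sym c v2 v1 tt) (≡-sym e₁)) (trans (col-sym c v4 v3 tt) (≡-sym e₂))
    (locating v2 v4 λ ())

bowtie-needs-five : ∀ j (c : EdgeColoring bowtie j) → IsEdgeLocating bowtie c → 5 ≤ j
bowtie-needs-five j c locating =
  ≤∧≢⇒< (degree≤colours c fsuc bowtie-hub-spokes suc-injective) four-fails
  where
  four-fails : 4 ≢ j
  four-fails refl = bowtie-four-not-locating c locating

theorem16 : ∃[ m ] ∃[ n ] Σ (Graph m) λ G → Σ (Graph n) λ H →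
    Connected G × Connected H × ProperSubgraph G H ×
    (∃[ a ] ∃[ b ] (IsChiL H a × IsChiL G b × a < b))
theorem16 = 5 , 5 , bowtie , chordedBowtie
  , dominating⇒connected bowtie v0 bowtie-dominated
  , dominating⇒connected chordedBowtie v0 chordedBowtie-dominated
  , bowtie⊂chordedBowtie
  , 4 , 5 , (chordedBowtie-locating , chordedBowtie-needs-four)
          , (bowtie-locating , bowtie-needs-five)
          , ≤-refl
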